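{- Let $n\ge 3$ and consider a simple tripartite-circle drawing of $K_{2,2,n}$ with the conventions and notation below. Let $z_1=\min\{d_n(y_1,y_2),d_n(y_2,y_1)\}$, $z_3=\min\{d_n(y_3,y_4),d_n(y_4,y_3)\}$, and \[ S=f_n(y_1,y_3)+f_n(y_1,y_4)+f_n(y_2,y_3)+f_n(y_2,y_4)-4\left\lfloor\frac{n}{2}\right\rfloor\left\lfloor\frac{n-1}{2}\right\rfloor . \] (i) If $y_1,y_2\in[y_3,y_4]$ or $y_1,y_2\in[y_4,y_3]$, then $S\geq z_1^2+z_3^2-\Delta_n\Delta_{z_1+z_3}$. (ii) If $y_1\in(y_3,y_4)$ and $y_2\in(y_4,y_3)$, or vice versa, then $S\geq \frac14\left(z_1^2+(n-z_1)^2+z_3^2+(n-z_3)^2\right)-\frac12\Delta_n$. Moreover, in all cases $S\geq z_1^2-\Delta_n\Delta_{z_1}$.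
   Context: A tripartite-circle drawing places the vertices of each of the three parts of a tripartite graph on one of three pairwise disjoint circles, with no edge crossing a circle; it is simple if no edge crosses itself, adjacent edges do not cross, and independent edges meet at most once. For $K_{2,2,n}$ the drawing is normalized so that the circle $\textsc{p}$ carrying the part of size $n$ encloses the other two (inner) circles $\textsc{m}$ and $\textsc{n}$, which are not nested; $\textsc{m}$ carries vertices $1,2$ and $\textsc{n}$ carries vertices $3,4$. Vertices on $\textsc{p}$ are labeled $1,\dots,n$ in counterclockwise order, and arcs $[k,\ell]$ (closed) and $(k,\ell)$ (open) on $\textsc{p}$ are read counterclockwise from $k$ to $\ell$. For $k,\ell\in\{1,\dots,n\}$ let $d_n(k,\ell)=(\ell-k)\bmod n\in\{0,\dots,n-1\}$ and $f_n(u,v)=\binom{d_n(u,v)}{2}+\binom{n-d_n(u,v)}{2}$. For an integer $k$, $\Delta_k=0$ if $k$ is even and $\Delta_k=1$ if $k$ is odd. For an inner vertex $j\in\{1,2,3,4\}$ on inner circle $\textsc{a}$, with $\textsc{c}$ the other inner circle: the star of all edges from $j$ to the vertices of $\textsc{p}$, together with $\textsc{p}$, partitions the plane into regions; exactly one region contains $\textsc{c}$, it is bounded by two edges from $j$ and an arc of $\textsc{p}$ between two consecutive vertices, and $y_j$ is the second of these two vertices in counterclockwise order. -}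

module Defs where

open import Data.Nat using (ℕ; zero; suc; _+_; _*_; _∸_; _≤_; _<_; _≤ᵇ_; _/_; _%_)
open import Data.Nat.Combinatorics using (_C_)
open import Data.Fin using (Fin; toℕ)
open import Data.Bool using (if_then_else_)
open import Data.Integer as ℤ using (ℤ; +_)
open import Data.Product using (_×_)
open import Data.Sum using (_⊎_)

-- Vertices 1,…,n on circle P are represented by Fin n (vertex k ↦ index k-1);
-- d_n only depends on differences, so this shift is harmless.

d : (n : ℕ) → Fin n → Fin n → ℕ
d n k l = if toℕ k ≤ᵇ toℕ l then toℕ l ∸ toℕ k else (n + toℕ l) ∸ toℕ k

f : (n : ℕ) → Fin n → Fin n → ℕ
f n u v = (d n u v C 2) + ((n ∸ d n u v) C 2)

Δ : ℕ → ℕ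
Δ k = k % 2

-- closed counterclockwise arc [k,l] on P  ([k,k] = {k})
_∈[_,_] : {n : ℕ} → Fin n → Fin n → Fin n → Set
_∈[_,_] {n} x k l = d n k x ≤ d n k l

-- open counterclockwise arc (k,l) on P  ((k,k) = ∅)
_∈⟨_,_⟩ : {n : ℕ} → Fin n → Fin n → Fin n → Set
_∈⟨_,_⟩ {n} x k l = (0 < d n k x) × (d n k x < d n k l)

min : ℕ → ℕ → ℕ
min a b = if a ≤ᵇ b then a else b

z : (n : ℕ) → Fin n → Fin n → ℕ
z n a b = min (d n a b) (d n b a)

S : (n : ℕ) → (y₁ y₂ y₃ y₄ : Fin n) → ℤ
S n y₁ y₂ y₃ y₄ =
  (+ (f n y₁ y₃ + f n y₁ y₄ + f n y₂ y₃ + f n y₂ y₄))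
  ℤ.- (+ (4 * ((n / 2) * ((n ∸ 1) / 2))))

sq : ℕ → ℤ
sq a = + (a * a)

-- Doubling S turns each f_n(u,v) = C(d,2) + C(n-d,2) into d² + (n-d)² - n and
-- 4⌊n/2⌋⌊(n-1)/2⌋ into n² - 2n + Δ_n, so that 2S = Q(y₃) + Q(y₄) - 2Δ_n, where
-- Q(w) = (a-b)² + (n-a-b)² for the distances a, b from y₁, y₂ to w.  Q does not change when a
-- distance is replaced by its complement n - a, so every distance may be measured from y₃ or y₄.
-- (i) If y₁, y₂ lie on an arc [c,e] of length L, then Q(c) + Q(e) = 2((a-b)² + (L-a-b)² + (n-L)²)
--     with z₁ ≤ |a-b| and z₃ ≤ n-L; the three bases sum to n modulo 2, so for odd n and even
--     z₁ + z₃ the inequality z₁² + z₃² ≤ sum of the three squares is strict.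
-- (ii) If y₁, y₂ lie on opposite arcs, 4(Q(c) + Q(e)) - 2(z₁² + (n-z₁)² + z₃² + (n-z₃)²) is a sum of
--     four squares (2k-n)², each at least Δ_n.
-- The last bound applies the parity argument of (i) to Q(y₃) and Q(y₄) separately.

module Submission where

open import Defs
open import Data.Bool using (true; false; T)
open import Data.Empty using (⊥-elim)
open import Data.Fin using (Fin; toℕ)
open import Data.Fin.Properties using (toℕ<n)
open import Data.Integer as ℤ using (ℤ; +_)
import Data.Integer.Properties as ℤₚ
open import Data.Integer.Tactic.RingSolver using () renaming (solve-∀ to ℤ-solve-∀; solve to ℤ-solve)
open import Data.List using (_∷_; [])
open import Data.Nat as ℕ
  using (ℕ; zero; suc; _+_; _*_; _∸_; _≤_; _<_; _≤ᵇ_; _⊓_; ∣_-_∣; z≤n; s≤s; s≤s⁻¹; z<s; NonZero)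
open import Data.Nat.Combinatorics using (_C_; nC1≡n; nCk+nC[k+1]≡[n+1]C[k+1])
open import Data.Nat.DivMod using (_/_; [m+kn]%n≡m%n; m<n⇒m%n≡m; m%n<n; m/n≡1+[m∸n]/n)
open import Data.Nat.Properties
open import Data.Nat.Tactic.RingSolver using (solve; solve-∀)
open import Data.Product using (_×_; _,_; ∃₂)
open import Data.Sum using (_⊎_; inj₁; inj₂)
open import Data.Unit using (tt)
open import Relation.Binary.PropositionalEquality

infix 4 _≡_mod_

_≡_mod_ : ℕ → ℕ → ℕ → Set
_≡_mod_ x y n = ∃₂ λ p q → x + p * n ≡ y + q * n

module _ {n : ℕ} where

  ≡⇒≡mod : ∀ {x y} → x ≡ y → x ≡ y mod n
  ≡⇒≡mod refl = 0 , 0 , refl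

  mod-sym : ∀ {x y} → x ≡ y mod n → y ≡ x mod n
  mod-sym (p , q , e) = q , p , sym e

  mod-trans : ∀ {x y w} → x ≡ y mod n → y ≡ w mod n → x ≡ w mod n
  mod-trans {x} {y} {w} (p , q , e) (r , s , e′) = p + r , q + s , (begin
    x + (p + r) * n     ≡⟨ solve (x ∷ p ∷ r ∷ n ∷ []) ⟩
    (x + p * n) + r * n ≡⟨ cong (_+ r * n) e ⟩
    (y + q * n) + r * n ≡⟨ solve (y ∷ q ∷ r ∷ n ∷ []) ⟩
    (y + r * n) + q * n ≡⟨ cong (_+ q * n) e′ ⟩
    (w + s * n) + q * n ≡⟨ solve (w ∷ s ∷ q ∷ n ∷ []) ⟩
    w + (q + s) * n     ∎)
    where open ≡-Reasoning

  mod-+ : ∀ {x x′ y y′} → x ≡ x′ mod n → y ≡ y′ mod n → x + y ≡ x′ + y′ mod n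
  mod-+ {x} {x′} {y} {y′} (p , q , e) (r , s , e′) = p + r , q + s , (begin
    x + y + (p + r) * n           ≡⟨ solve (x ∷ y ∷ p ∷ r ∷ n ∷ []) ⟩
    (x + p * n) + (y + r * n)     ≡⟨ cong₂ _+_ e e′ ⟩
    (x′ + q * n) + (y′ + s * n)   ≡⟨ solve (x′ ∷ y′ ∷ q ∷ s ∷ n ∷ []) ⟩
    x′ + y′ + (q + s) * n         ∎)
    where open ≡-Reasoning

  mod-cancelˡ : ∀ a {x y} → a + x ≡ a + y mod n → x ≡ y mod n
  mod-cancelˡ a {x} {y} (p , q , e) = p , q , +-cancelˡ-≡ a _ _ (begin
    a + (x + p * n) ≡⟨ +-assoc a x _ ⟨
    a + x + p * n   ≡⟨ e ⟩
    a + y + q * n   ≡⟨ +-assoc a y _ ⟩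
    a + (y + q * n) ∎)
    where open ≡-Reasoning

  m+kn≡m-mod : ∀ m k → m + k * n ≡ m mod n
  m+kn≡m-mod m k = 0 , k , +-identityʳ _

  m+n≡m-mod : ∀ m → m + n ≡ m mod n
  m+n≡m-mod m = 0 , 1 , solve (m ∷ n ∷ [])

  n+m≡m-mod : ∀ m → n + m ≡ m mod n
  n+m≡m-mod m = 0 , 1 , solve (m ∷ n ∷ [])

  mod-unique : ∀ {x y} → x < n → y < n → x ≡ y mod n → x ≡ y
  mod-unique {x} {y} x<n y<n (p , q , e) = begin
    x                     ≡⟨ m<n⇒m%n≡m x<n ⟨
    x ℕ.% n               ≡⟨ [m+kn]%n≡m%n x p n ⟨
    (x + p * n) ℕ.% n     ≡⟨ cong (ℕ._% n) e ⟩
    (y + q * n) ℕ.% n     ≡⟨ [m+kn]%n≡m%n y q n ⟩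
    y ℕ.% n               ≡⟨ m<n⇒m%n≡m y<n ⟩
    y                     ∎
    where
    open ≡-Reasoning
    instance
      n≢0 : NonZero n
      n≢0 = ℕ.>-nonZero (≤-<-trans z≤n x<n)

module _ {n : ℕ} where

  d-cases : (k l : Fin n) →
            (toℕ k ≤ toℕ l × d n k l ≡ toℕ l ∸ toℕ k) ⊎ (toℕ l < toℕ k × d n k l ≡ n + toℕ l ∸ toℕ k)
  d-cases k l with toℕ k ≤ᵇ toℕ l in eq
  ... | true  = inj₁ (≤ᵇ⇒≤ (toℕ k) (toℕ l) (subst T (sym eq) tt) , refl)
  ... | false = inj₂ (≰⇒> (λ k≤l → subst T eq (≤⇒≤ᵇ k≤l)) , refl)

  private
    k≤n+l : (k l : Fin n) → toℕ k ≤ n + toℕ l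
    k≤n+l k l = ≤-trans (<⇒≤ (toℕ<n k)) (m≤m+n n (toℕ l))

  d<n : (k l : Fin n) → d n k l < n
  d<n k l with d-cases k l
  ... | inj₁ (_ , e) rewrite e = ≤-<-trans (m∸n≤m (toℕ l) (toℕ k)) (toℕ<n l)
  ... | inj₂ (l<k , e) rewrite e = +-cancelʳ-< (toℕ k) _ n (begin-strict
    n + toℕ l ∸ toℕ k + toℕ k ≡⟨ m∸n+n≡m (k≤n+l k l) ⟩
    n + toℕ l                 <⟨ +-monoʳ-< n l<k ⟩
    n + toℕ k                 ∎)
    where open ≤-Reasoning

  d-residue : (k l : Fin n) → toℕ k + d n k l ≡ toℕ l mod n
  d-residue k l with d-cases k l
  ... | inj₁ (k≤l , e) rewrite e = ≡⇒≡mod (m+[n∸m]≡n k≤l)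
  ... | inj₂ (_ , e) rewrite e =
    mod-trans (≡⇒≡mod (m+[n∸m]≡n (k≤n+l k l))) (n+m≡m-mod (toℕ l))

  d-unique : ∀ (k l : Fin n) {x} → x < n → toℕ k + x ≡ toℕ l mod n → d n k l ≡ x
  d-unique k l x<n k+x≡l =
    mod-unique (d<n k l) x<n (mod-cancelˡ (toℕ k) (mod-trans (d-residue k l) (mod-sym k+x≡l)))

  d-∸ : (k l w : Fin n) → d n k l ≤ d n k w → d n l w ≡ d n k w ∸ d n k l
  d-∸ k l w kl≤kw = d-unique l w (≤-<-trans (m∸n≤m _ (d n k l)) (d<n k w))
    (mod-trans (mod-+ (mod-sym (d-residue k l)) (≡⇒≡mod refl))
    (mod-trans (≡⇒≡mod (trans (+-assoc (toℕ k) _ _) (cong (_+_ (toℕ k)) (m+[n∸m]≡n kl≤kw))))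
    (d-residue k w)))

  d-+ : (k l w : Fin n) → d n k l + d n l w < n → d n k w ≡ d n k l + d n l w
  d-+ k l w kl+lw<n = d-unique k w kl+lw<n
    (mod-trans (≡⇒≡mod (sym (+-assoc (toℕ k) _ _)))
    (mod-trans (mod-+ (d-residue k l) (≡⇒≡mod refl))
    (d-residue l w)))

  d-flip : (k l : Fin n) → (d n k l ≡ 0 × d n l k ≡ 0) ⊎ d n k l + d n l k ≡ n
  d-flip k l with d n k l in e | d-residue k l
  ... | zero  | k+0≡l = inj₁ (refl , d-unique l k (≤-<-trans z≤n (toℕ<n k)) l+0≡k)
    where
    l+0≡k : toℕ l + 0 ≡ toℕ k mod n
    l+0≡k = mod-trans (≡⇒≡mod (+-identityʳ (toℕ l)))
      (mod-sym (mod-trans (≡⇒≡mod (sym (+-identityʳ (toℕ k)))) k+0≡l))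
  ... | suc j | k+d≡l = inj₂ (trans (cong (_+_ (suc j)) lk≡n∸d) (m+[n∸m]≡n d≤n))
    where
    d≤n : suc j ≤ n
    d≤n = subst (_≤ n) e (<⇒≤ (d<n k l))
    lk≡n∸d : d n l k ≡ n ∸ suc j
    lk≡n∸d = d-unique l k (∸-monoʳ-< {n} {suc j} {0} (s≤s z≤n) d≤n)
      (mod-trans (mod-+ (mod-sym k+d≡l) (≡⇒≡mod refl))
      (mod-trans (≡⇒≡mod (trans (+-assoc (toℕ k) _ _) (cong (_+_ (toℕ k)) (m+[n∸m]≡n d≤n))))
      (m+n≡m-mod (toℕ k))))

  d+d≡n : (k l : Fin n) → 0 < d n k l → d n k l + d n l k ≡ n
  d+d≡n k l 0<d with d-flip k l
  ... | inj₁ (kl≡0 , _) = ⊥-elim (<-irrefl (sym kl≡0) 0<d)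
  ... | inj₂ kl+lk≡n    = kl+lk≡n

min≡⊓ : ∀ a b → min a b ≡ a ⊓ b
min≡⊓ a b with a ≤ᵇ b in eq
... | true  = sym (m≤n⇒m⊓n≡m (≤ᵇ⇒≤ a b (subst T (sym eq) tt)))
... | false = sym (m≥n⇒m⊓n≡n (<⇒≤ (≰⇒> (λ a≤b → subst T eq (≤⇒≤ᵇ a≤b)))))

module _ {n : ℕ} where

  z≤d : (a b : Fin n) → z n a b ≤ d n a b
  z≤d a b = subst (_≤ d n a b) (sym (min≡⊓ (d n a b) _)) (m⊓n≤m _ _)

  z≤d′ : (a b : Fin n) → z n a b ≤ d n b a
  z≤d′ a b = subst (_≤ d n b a) (sym (min≡⊓ (d n a b) _)) (m⊓n≤n _ _)

  z≤∣d-d∣ : (y₁ y₂ w : Fin n) → z n y₁ y₂ ≤ ∣ d n w y₁ - d n w y₂ ∣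
  z≤∣d-d∣ y₁ y₂ w with ≤-total (d n w y₁) (d n w y₂)
  ... | inj₁ w₁≤w₂ rewrite m≤n⇒∣m-n∣≡n∸m w₁≤w₂ = subst (z n y₁ y₂ ≤_) (d-∸ w y₁ y₂ w₁≤w₂) (z≤d y₁ y₂)
  ... | inj₂ w₂≤w₁ rewrite m≤n⇒∣n-m∣≡n∸m w₂≤w₁ = subst (z n y₁ y₂ ≤_) (d-∸ w y₂ y₁ w₂≤w₁) (z≤d′ y₁ y₂)

  z≤n∸d : (c e : Fin n) → z n c e ≤ n ∸ d n c e
  z≤n∸d c e with d-flip c e
  ... | inj₁ (ce≡0 , _) = ≤-trans (subst (z n c e ≤_) ce≡0 (z≤d c e)) z≤n
  ... | inj₂ ce+ec≡n =
    subst (z n c e ≤_) (trans (sym (m+n∸m≡n (d n c e) _)) (cong (_∸ d n c e) ce+ec≡n)) (z≤d′ c e)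

  z-comm : (a b : Fin n) → z n a b ≡ z n b a
  z-comm a b = trans (min≡⊓ (d n a b) _) (trans (⊓-comm (d n a b) _) (sym (min≡⊓ (d n b a) _)))

  z-sel : (k l : Fin n) → z n k l ≡ d n k l ⊎ z n k l ≡ d n l k
  z-sel k l rewrite min≡⊓ (d n k l) (d n l k) = ⊓-sel (d n k l) (d n l k)

Δ-cases : ∀ x → Δ x ≡ 0 ⊎ Δ x ≡ 1
Δ-cases x with x ℕ.% 2 | m%n<n x 2
... | 0 | _ = inj₁ refl
... | 1 | _ = inj₂ refl
... | suc (suc _) | s≤s (s≤s ())

Δ-cong : ∀ {x y} → x ≡ y mod 2 → Δ x ≡ Δ y
Δ-cong {x} {y} (p , q , e) = begin
  x ℕ.% 2               ≡⟨ [m+kn]%n≡m%n x p 2 ⟨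
  (x + p * 2) ℕ.% 2     ≡⟨ cong (ℕ._% 2) e ⟩
  (y + q * 2) ℕ.% 2     ≡⟨ [m+kn]%n≡m%n y q 2 ⟩
  y ℕ.% 2               ∎
  where open ≡-Reasoning

∣m-n∣≡m+n-mod2 : ∀ m k → ∣ m - k ∣ ≡ m + k mod 2
∣m-n∣≡m+n-mod2 zero    k       = ≡⇒≡mod refl
∣m-n∣≡m+n-mod2 (suc m) zero    = ≡⇒≡mod (sym (+-identityʳ (suc m)))
∣m-n∣≡m+n-mod2 (suc m) (suc k) =
  mod-trans (∣m-n∣≡m+n-mod2 m k)
    (mod-sym (mod-trans (≡⇒≡mod shift) (m+n≡m-mod (m + k))))
  where
  shift : suc m + suc k ≡ m + k + 2
  shift = solve (m ∷ k ∷ [])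

∣m+m-n∣≡n-mod2 : ∀ m n → ∣ m + m - n ∣ ≡ n mod 2
∣m+m-n∣≡n-mod2 m n = mod-trans (∣m-n∣≡m+n-mod2 (m + m) n)
  (mod-trans (≡⇒≡mod rearrange) (m+kn≡m-mod n m))
  where
  rearrange : m + m + n ≡ n + m * 2
  rearrange = solve (m ∷ n ∷ [])

∣a-b∣+∣N-[a+b]∣≡N-mod2 : ∀ N a b → ∣ a - b ∣ + ∣ N - (a + b) ∣ ≡ N mod 2
∣a-b∣+∣N-[a+b]∣≡N-mod2 N a b = mod-trans (mod-+ (∣m-n∣≡m+n-mod2 a b) (∣m-n∣≡m+n-mod2 N (a + b)))
  (mod-trans (≡⇒≡mod (rearrange (a + b) N)) (m+kn≡m-mod N (a + b)))
  where
  rearrange : ∀ x N → x + (N + x) ≡ N + x * 2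
  rearrange = solve-∀

Δ≤x*x : ∀ {x n} → x ≡ n mod 2 → Δ n ≤ x * x
Δ≤x*x {zero}  0≡n = ≤-reflexive (sym (Δ-cong 0≡n))
Δ≤x*x {suc x} {n} _ = ≤-trans (s≤s⁻¹ (m%n<n n 2)) (s≤s z≤n)

sum-sq-mono : ∀ {z₁ z₃ u w} v → z₁ ≤ u → z₃ ≤ w → z₁ * z₁ + z₃ * z₃ ≤ u * u + v * v + w * w
sum-sq-mono {u = u} {w} v z₁≤u z₃≤w =
  ≤-trans (+-mono-≤ (*-mono-≤ z₁≤u z₁≤u) (*-mono-≤ z₃≤w z₃≤w)) (+-monoˡ-≤ (w * w) (m≤m+n (u * u) (v * v)))

sum-sq-mono-< : ∀ {z₁ z₃ u w} v → z₁ ≤ u → z₃ ≤ w → Δ (z₁ + z₃) ≢ Δ (u + v + w) →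
              z₁ * z₁ + z₃ * z₃ < u * u + v * v + w * w
sum-sq-mono-< {z₁} {z₃} {u} {w} v z₁≤u z₃≤w Δ≢Δ with m≤n⇒m<n∨m≡n z₁≤u | m≤n⇒m<n∨m≡n z₃≤w
... | inj₁ z₁<u | _ = <-≤-trans (+-mono-<-≤ (*-mono-< z₁<u z₁<u) (*-mono-≤ z₃≤w z₃≤w)) u²+w²≤
  where u²+w²≤ = +-monoˡ-≤ (w * w) (m≤m+n (u * u) (v * v))
... | inj₂ _ | inj₁ z₃<w = <-≤-trans (+-mono-≤-< (*-mono-≤ z₁≤u z₁≤u) (*-mono-< z₃<w z₃<w)) u²+w²≤
  where u²+w²≤ = +-monoˡ-≤ (w * w) (m≤m+n (u * u) (v * v))
... | inj₂ refl | inj₂ refl with v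
...   | zero   = ⊥-elim (Δ≢Δ (cong (λ t → Δ (t + z₃)) (sym (+-identityʳ z₁))))
...   | suc v′ = +-monoˡ-< (z₃ * z₃) (m<m+n (z₁ * z₁) z<s)

squares-parity-bound : ∀ {n z₁ z₃ u v w} → z₁ ≤ u → z₃ ≤ w → u + v + w ≡ n mod 2 →
  z₁ * z₁ + z₃ * z₃ + Δ n ≤ u * u + v * v + w * w + Δ n * Δ (z₁ + z₃)
squares-parity-bound {n} {z₁} {z₃} {v = v} z₁≤u z₃≤w parity with Δ-cases n | Δ-cases (z₁ + z₃)
... | inj₁ Δn≡0 | _         rewrite Δn≡0 = +-monoˡ-≤ 0 (sum-sq-mono v z₁≤u z₃≤w)
... | inj₂ Δn≡1 | inj₂ Δz≡1 rewrite Δn≡1 | Δz≡1 = +-monoˡ-≤ 1 (sum-sq-mono v z₁≤u z₃≤w)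
... | inj₂ Δn≡1 | inj₁ Δz≡0 rewrite Δn≡1 | Δz≡0 =
  subst₂ _≤_ (+-comm 1 _) (sym (+-identityʳ _)) (sum-sq-mono-< v z₁≤u z₃≤w
    (λ Δ≡Δ → 0≢1+n (trans (sym Δz≡0) (trans Δ≡Δ (trans (Δ-cong parity) Δn≡1)))))

squares-parity-bound₂ : ∀ {n z u v} → z ≤ u → u + v ≡ n mod 2 →
  z * z + Δ n ≤ u * u + v * v + Δ n * Δ z
squares-parity-bound₂ {n} {z} {u} {v} z≤u parity = subst₂ _≤_
  (cong (_+ Δ n) (+-identityʳ (z * z)))
  (cong₂ (λ s t → s + Δ n * Δ t) (+-identityʳ (u * u + v * v)) (+-identityʳ z))
  (squares-parity-bound z≤u z≤n (mod-trans (≡⇒≡mod (+-identityʳ (u + v))) parity))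

2*[mC2]+m≡m*m : ∀ m → 2 * (m C 2) + m ≡ m * m
2*[mC2]+m≡m*m zero    = refl
2*[mC2]+m≡m*m (suc m) = begin
  2 * (suc m C 2) + suc m        ≡⟨ cong (λ c → 2 * c + suc m) (nCk+nC[k+1]≡[n+1]C[k+1] m 1) ⟨
  2 * (m C 1 + m C 2) + suc m    ≡⟨ cong (λ c → 2 * (c + m C 2) + suc m) (nC1≡n m) ⟩
  2 * (m + m C 2) + suc m        ≡⟨ rearrange m (m C 2) ⟩
  (2 * (m C 2) + m) + 2 * m + 1  ≡⟨ cong (λ s → s + 2 * m + 1) (2*[mC2]+m≡m*m m) ⟩
  m * m + 2 * m + 1              ≡⟨ solve (m ∷ []) ⟩
  suc m * suc m                  ∎
  where
  open ≡-Reasoning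
  rearrange : ∀ m c → 2 * (m + c) + suc m ≡ (2 * c + m) + 2 * m + 1
  rearrange = solve-∀

m/2+[1+m]/2≡m : ∀ m → m / 2 + suc m / 2 ≡ m
m/2+[1+m]/2≡m zero    = refl
m/2+[1+m]/2≡m (suc m) = begin
  suc m / 2 + suc (suc m) / 2   ≡⟨ cong (_+_ (suc m / 2)) (m/n≡1+[m∸n]/n {suc (suc m)} {2} (s≤s (s≤s z≤n))) ⟩
  suc m / 2 + suc (m / 2)       ≡⟨ +-suc (suc m / 2) (m / 2) ⟩
  suc (suc m / 2 + m / 2)       ≡⟨ cong suc (+-comm (suc m / 2) (m / 2)) ⟩
  suc (m / 2 + suc m / 2)       ≡⟨ cong suc (m/2+[1+m]/2≡m m) ⟩
  suc m                         ∎
  where open ≡-Reasoning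

4*[n/2]*[[n∸1]/2]+2n≡n*n+Δn : ∀ n → 4 * ((n / 2) * ((n ∸ 1) / 2)) + 2 * n ≡ n * n + Δ n
4*[n/2]*[[n∸1]/2]+2n≡n*n+Δn zero                = refl
4*[n/2]*[[n∸1]/2]+2n≡n*n+Δn (suc zero)          = refl
4*[n/2]*[[n∸1]/2]+2n≡n*n+Δn (suc (suc zero))    = refl
4*[n/2]*[[n∸1]/2]+2n≡n*n+Δn (suc (suc (suc m))) = begin
  4 * ((3+m / 2) * (2+m / 2)) + 2 * 3+m
    ≡⟨ cong₂ (λ x y → 4 * (x * y) + 2 * 3+m) (m/n≡1+[m∸n]/n {3+m} {2} (s≤s (s≤s z≤n)))
                                                (m/n≡1+[m∸n]/n {2+m} {2} (s≤s (s≤s z≤n))) ⟩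
  4 * ((1 + suc m / 2) * (1 + m / 2)) + 2 * 3+m
    ≡⟨ rearrange (suc m / 2) (m / 2) m ⟩
  (4 * ((suc m / 2) * (m / 2)) + 2 * suc m) + 4 * (m / 2 + suc m / 2) + 8
    ≡⟨ cong₂ (λ x y → x + 4 * y + 8) (4*[n/2]*[[n∸1]/2]+2n≡n*n+Δn (suc m)) (m/2+[1+m]/2≡m m) ⟩
  (suc m * suc m + Δ (suc m)) + 4 * m + 8
    ≡⟨ square-step m (Δ (suc m)) ⟩
  3+m * 3+m + Δ (suc m)
    ≡⟨ cong (_+_ (3+m * 3+m)) (sym (Δ-cong (n+m≡m-mod (suc m)))) ⟩
  3+m * 3+m + Δ 3+m ∎
  where
  open ≡-Reasoning
  3+m = suc (suc (suc m))
  2+m = suc (suc m)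
  rearrange : ∀ a b m → 4 * ((1 + a) * (1 + b)) + 2 * (3 + m) ≡ (4 * (a * b) + 2 * suc m) + 4 * (b + a) + 8
  rearrange = solve-∀
  square-step : ∀ m r → (suc m * suc m + r) + 4 * m + 8 ≡ (3 + m) * (3 + m) + r
  square-step = solve-∀

pos-∸ : ∀ {a b} → b ≤ a → + (a ∸ b) ≡ + a ℤ.- + b
pos-∸ {a} {b} b≤a = sym (trans (ℤₚ.m-n≡m⊖n a b) (ℤₚ.⊖-≥ b≤a))

m+n≡o⇒+m≡+o-+n : ∀ {m k o} → m + k ≡ o → + m ≡ + o ℤ.- + k
m+n≡o⇒+m≡+o-+n {m} {k} refl = trans (cong +_ (sym (m+n∸n≡m m k))) (pos-∸ (m≤n+m k m))

sq-∣-∣ : ∀ a b → sq ∣ a - b ∣ ≡ (+ a ℤ.- + b) ℤ.* (+ a ℤ.- + b)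
sq-∣-∣ a b with ≤-total a b
... | inj₁ a≤b rewrite m≤n⇒∣m-n∣≡n∸m a≤b =
  trans (ℤₚ.pos-* (b ∸ a) _) (trans (cong (λ t → t ℤ.* t) (pos-∸ a≤b)) (swap (+ a) (+ b)))
  where
  swap : ∀ a b → (b ℤ.- a) ℤ.* (b ℤ.- a) ≡ (a ℤ.- b) ℤ.* (a ℤ.- b)
  swap = ℤ-solve-∀
... | inj₂ b≤a rewrite m≤n⇒∣n-m∣≡n∸m b≤a =
  trans (ℤₚ.pos-* (a ∸ b) _) (cong (λ t → t ℤ.* t) (pos-∸ b≤a))

m+q≤o+n⇒+m-+n≤+o-+q : ∀ {m n o q} → m + q ≤ o + n → + m ℤ.- + n ℤ.≤ + o ℤ.- + q
m+q≤o+n⇒+m-+n≤+o-+q {m} {n} {o} {q} m+q≤o+n = ℤₚ.0≤i-j⇒j≤i (subst (ℤ._≤_ (+ 0)) difference (ℤ.+≤+ z≤n))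
  where
  regroup : ∀ m n o q → (o ℤ.+ n) ℤ.- (m ℤ.+ q) ≡ (o ℤ.- q) ℤ.- (m ℤ.- n)
  regroup = ℤ-solve-∀
  difference : + (o + n ∸ (m + q)) ≡ (+ o ℤ.- + q) ℤ.- (+ m ℤ.- + n)
  difference = trans (pos-∸ m+q≤o+n)
    (trans (cong₂ ℤ._-_ (ℤₚ.pos-+ o n) (ℤₚ.pos-+ m q)) (regroup (+ m) (+ n) (+ o) (+ q)))

Q : ℤ → ℤ → ℤ → ℤ
Q n a b = (a ℤ.- b) ℤ.* (a ℤ.- b) ℤ.+ (n ℤ.- (a ℤ.+ b)) ℤ.* (n ℤ.- (a ℤ.+ b))

g : ℤ → ℤ → ℤ
g n x = x ℤ.* x ℤ.+ (n ℤ.- x) ℤ.* (n ℤ.- x)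

[2k-n]² : ℤ → ℤ → ℤ
[2k-n]² n k = (k ℤ.+ k ℤ.- n) ℤ.* (k ℤ.+ k ℤ.- n)

-- The ring solver does not unfold Q, g and [2k-n]², so each identity is solved in expanded form.
g+g-n²≡Q : ∀ n a b → g n a ℤ.+ g n b ℤ.- n ℤ.* n ≡ Q n a b
g+g-n²≡Q = expanded
  where
  expanded : ∀ n a b →
    let Q = λ n a b → (a ℤ.- b) ℤ.* (a ℤ.- b) ℤ.+ (n ℤ.- (a ℤ.+ b)) ℤ.* (n ℤ.- (a ℤ.+ b))
        g = λ n x → x ℤ.* x ℤ.+ (n ℤ.- x) ℤ.* (n ℤ.- x)
    in g n a ℤ.+ g n b ℤ.- n ℤ.* n ≡ Q n a b
  expanded = ℤ-solve-∀

Q-reflectˡ : ∀ n a b → Q n (n ℤ.- a) b ≡ Q n a b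
Q-reflectˡ = expanded
  where
  expanded : ∀ n a b →
    let Q = λ n a b → (a ℤ.- b) ℤ.* (a ℤ.- b) ℤ.+ (n ℤ.- (a ℤ.+ b)) ℤ.* (n ℤ.- (a ℤ.+ b))
    in Q n (n ℤ.- a) b ≡ Q n a b
  expanded = ℤ-solve-∀

Q-comm : ∀ n a b → Q n a b ≡ Q n b a
Q-comm = expanded
  where
  expanded : ∀ n a b →
    let Q = λ n a b → (a ℤ.- b) ℤ.* (a ℤ.- b) ℤ.+ (n ℤ.- (a ℤ.+ b)) ℤ.* (n ℤ.- (a ℤ.+ b))
    in Q n a b ≡ Q n b a
  expanded = ℤ-solve-∀

g-reflect : ∀ n x → g n (n ℤ.- x) ≡ g n x
g-reflect = expanded
  where
  expanded : ∀ n x →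
    let g = λ n x → x ℤ.* x ℤ.+ (n ℤ.- x) ℤ.* (n ℤ.- x)
    in g n (n ℤ.- x) ≡ g n x
  expanded = ℤ-solve-∀

Q+Q-nested : ∀ n L a b →
  Q n a b ℤ.+ Q n (L ℤ.- a) (L ℤ.- b) ≡
  + 2 ℤ.* ((a ℤ.- b) ℤ.* (a ℤ.- b) ℤ.+ (L ℤ.- (a ℤ.+ b)) ℤ.* (L ℤ.- (a ℤ.+ b)) ℤ.+ (n ℤ.- L) ℤ.* (n ℤ.- L))
Q+Q-nested = expanded
  where
  expanded : ∀ n L a b →
    let Q = λ n a b → (a ℤ.- b) ℤ.* (a ℤ.- b) ℤ.+ (n ℤ.- (a ℤ.+ b)) ℤ.* (n ℤ.- (a ℤ.+ b))
    in Q n a b ℤ.+ Q n (L ℤ.- a) (L ℤ.- b) ≡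
       + 2 ℤ.* ((a ℤ.- b) ℤ.* (a ℤ.- b) ℤ.+ (L ℤ.- (a ℤ.+ b)) ℤ.* (L ℤ.- (a ℤ.+ b)) ℤ.+ (n ℤ.- L) ℤ.* (n ℤ.- L))
  expanded = ℤ-solve-∀

Q+Q-crossing : ∀ n L a B →
  + 4 ℤ.* (Q n a (L ℤ.+ B) ℤ.+ Q n (n ℤ.- L ℤ.+ a) B) ≡
  + 2 ℤ.* (g n (L ℤ.- a ℤ.+ B) ℤ.+ g n L) ℤ.+
  ([2k-n]² n (L ℤ.- a ℤ.+ B) ℤ.+ + 2 ℤ.* [2k-n]² n (a ℤ.+ B) ℤ.+ [2k-n]² n L)
Q+Q-crossing = expanded
  where
  expanded : ∀ n L a B →
    let Q = λ n a b → (a ℤ.- b) ℤ.* (a ℤ.- b) ℤ.+ (n ℤ.- (a ℤ.+ b)) ℤ.* (n ℤ.- (a ℤ.+ b))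
        g = λ n x → x ℤ.* x ℤ.+ (n ℤ.- x) ℤ.* (n ℤ.- x)
        [2k-n]² = λ n k → (k ℤ.+ k ℤ.- n) ℤ.* (k ℤ.+ k ℤ.- n)
    in + 4 ℤ.* (Q n a (L ℤ.+ B) ℤ.+ Q n (n ℤ.- L ℤ.+ a) B) ≡
       + 2 ℤ.* (g n (L ℤ.- a ℤ.+ B) ℤ.+ g n L) ℤ.+
       ([2k-n]² n (L ℤ.- a ℤ.+ B) ℤ.+ + 2 ℤ.* [2k-n]² n (a ℤ.+ B) ℤ.+ [2k-n]² n L)
  expanded = ℤ-solve-∀

Q≡sq+sq : ∀ N a b → Q (+ N) (+ a) (+ b) ≡ sq ∣ a - b ∣ ℤ.+ sq ∣ N - (a + b) ∣
Q≡sq+sq N a b = sym (cong₂ ℤ._+_ (sq-∣-∣ a b)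
  (trans (sq-∣-∣ N (a + b)) (cong (λ t → (+ N ℤ.- t) ℤ.* (+ N ℤ.- t)) (ℤₚ.pos-+ a b))))

sq+sq≡g : ∀ {n x} → x ≤ n → sq x ℤ.+ sq (n ∸ x) ≡ g (+ n) (+ x)
sq+sq≡g {n} {x} x≤n =
  cong₂ ℤ._+_ (ℤₚ.pos-* x x) (trans (ℤₚ.pos-* (n ∸ x) _) (cong (λ t → t ℤ.* t) (pos-∸ x≤n)))

Δ≤[2k-n]² : ∀ n k → + Δ n ℤ.≤ [2k-n]² (+ n) (+ k)
Δ≤[2k-n]² n k = subst (+ Δ n ℤ.≤_)
  (trans (sq-∣-∣ (k + k) n) (cong (λ t → (t ℤ.- + n) ℤ.* (t ℤ.- + n)) (ℤₚ.pos-+ k k)))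
  (ℤ.+≤+ (Δ≤x*x (∣m+m-n∣≡n-mod2 k n)))

crossing-arithmetic : ∀ {G D Σ T s : ℤ} → + 2 ℤ.* s ≡ T ℤ.- + 2 ℤ.* D → + 4 ℤ.* T ≡ + 2 ℤ.* G ℤ.+ Σ →
  + 4 ℤ.* D ℤ.≤ Σ → G ℤ.- + 2 ℤ.* D ℤ.≤ + 4 ℤ.* s
crossing-arithmetic {G} {D} {Σ} {T} {s} 2s≡T-2D 4T≡2G+Σ 4D≤Σ =
  ℤₚ.*-cancelˡ-≤-pos (G ℤ.- + 2 ℤ.* D) (+ 4 ℤ.* s) (+ 2) (begin
    + 2 ℤ.* (G ℤ.- + 2 ℤ.* D)              ≡⟨ ℤ-solve (G ∷ D ∷ []) ⟩
    + 2 ℤ.* G ℤ.+ + 4 ℤ.* D ℤ.- + 8 ℤ.* D  ≤⟨ ℤₚ.+-monoˡ-≤ (ℤ.- (+ 8 ℤ.* D)) (ℤₚ.+-monoʳ-≤ (+ 2 ℤ.* G) 4D≤Σ) ⟩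
    + 2 ℤ.* G ℤ.+ Σ ℤ.- + 8 ℤ.* D          ≡⟨ cong (ℤ._- + 8 ℤ.* D) 4T≡2G+Σ ⟨
    + 4 ℤ.* T ℤ.- + 8 ℤ.* D                ≡⟨ ℤ-solve (T ∷ D ∷ []) ⟩
    + 4 ℤ.* (T ℤ.- + 2 ℤ.* D)              ≡⟨ cong (+ 4 ℤ.*_) 2s≡T-2D ⟨
    + 4 ℤ.* (+ 2 ℤ.* s)                    ≡⟨ ℤ-solve (s ∷ []) ⟩
    + 2 ℤ.* (+ 4 ℤ.* s)                    ∎)
  where open ℤₚ.≤-Reasoning

2*f+n≡g : ∀ n (u v : Fin n) → + 2 ℤ.* + f n u v ℤ.+ + n ≡ g (+ n) (+ d n u v)
2*f+n≡g n u v = begin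
  + 2 ℤ.* + f n u v ℤ.+ + n  ≡⟨ cong (ℤ._+ + n) (ℤₚ.pos-* 2 (f n u v)) ⟨
  + (2 * f n u v) ℤ.+ + n    ≡⟨ ℤₚ.pos-+ (2 * f n u v) n ⟨
  + (2 * f n u v + n)        ≡⟨ cong +_ 2f+n≡D²+E² ⟩
  + (D * D + E * E)          ≡⟨ ℤₚ.pos-+ (D * D) (E * E) ⟩
  sq D ℤ.+ sq E              ≡⟨ sq+sq≡g D≤n ⟩
  g (+ n) (+ D)              ∎
  where
  open ≡-Reasoning
  D = d n u v
  E = n ∸ D
  D≤n : D ≤ n
  D≤n = <⇒≤ (d<n u v)
  rearrange : ∀ c c′ D E → 2 * (c + c′) + (D + E) ≡ (2 * c + D) + (2 * c′ + E)
  rearrange = solve-∀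
  2f+n≡D²+E² : 2 * f n u v + n ≡ D * D + E * E
  2f+n≡D²+E² = begin
    2 * (D C 2 + E C 2) + n              ≡⟨ cong (_+_ (2 * (D C 2 + E C 2))) (m+[n∸m]≡n D≤n) ⟨
    2 * (D C 2 + E C 2) + (D + E)        ≡⟨ rearrange (D C 2) (E C 2) D E ⟩
    (2 * (D C 2) + D) + (2 * (E C 2) + E) ≡⟨ cong₂ _+_ (2*[mC2]+m≡m*m D) (2*[mC2]+m≡m*m E) ⟩
    D * D + E * E                        ∎

pos-4*[n/2]*[[n∸1]/2] : ∀ n → + (4 * ((n / 2) * ((n ∸ 1) / 2))) ≡ + n ℤ.* + n ℤ.+ + Δ n ℤ.- + 2 ℤ.* + n
pos-4*[n/2]*[[n∸1]/2] n = begin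
  + (4 * ((n / 2) * ((n ∸ 1) / 2)))  ≡⟨ m+n≡o⇒+m≡+o-+n (4*[n/2]*[[n∸1]/2]+2n≡n*n+Δn n) ⟩
  + (n * n + Δ n) ℤ.- + (2 * n)      ≡⟨ cong₂ ℤ._-_ (trans (ℤₚ.pos-+ (n * n) (Δ n)) (cong (ℤ._+ + Δ n) (ℤₚ.pos-* n n)))
                                                     (ℤₚ.pos-* 2 n) ⟩
  + n ℤ.* + n ℤ.+ + Δ n ℤ.- + 2 ℤ.* + n ∎
  where open ≡-Reasoning

Q-at : ∀ n → (y₁ y₂ w : Fin n) → ℤ
Q-at n y₁ y₂ w = Q (+ n) (+ d n y₁ w) (+ d n y₂ w)

2*S≡Q-at+Q-at-2Δ : ∀ n (y₁ y₂ y₃ y₄ : Fin n) →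
  + 2 ℤ.* S n y₁ y₂ y₃ y₄ ≡ Q-at n y₁ y₂ y₃ ℤ.+ Q-at n y₁ y₂ y₄ ℤ.- + 2 ℤ.* + Δ n
2*S≡Q-at+Q-at-2Δ n y₁ y₂ y₃ y₄ = begin
  + 2 ℤ.* (+ (f₁₃ + f₁₄ + f₂₃ + f₂₄) ℤ.- + (4 * ((n / 2) * ((n ∸ 1) / 2))))
    ≡⟨ cong₂ (λ F M → + 2 ℤ.* (F ℤ.- M)) (pos-+₄ f₁₃ f₁₄ f₂₃ f₂₄) (pos-4*[n/2]*[[n∸1]/2] n) ⟩
  + 2 ℤ.* (+ f₁₃ ℤ.+ + f₁₄ ℤ.+ + f₂₃ ℤ.+ + f₂₄ ℤ.- (+ n ℤ.* + n ℤ.+ + Δ n ℤ.- + 2 ℤ.* + n))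
    ≡⟨ regroup (+ n) (+ Δ n) (+ f₁₃) (+ f₁₄) (+ f₂₃) (+ f₂₄) ⟩
  ((+ 2 ℤ.* + f₁₃ ℤ.+ + n) ℤ.+ (+ 2 ℤ.* + f₂₃ ℤ.+ + n) ℤ.- + n ℤ.* + n) ℤ.+
  ((+ 2 ℤ.* + f₁₄ ℤ.+ + n) ℤ.+ (+ 2 ℤ.* + f₂₄ ℤ.+ + n) ℤ.- + n ℤ.* + n) ℤ.- + 2 ℤ.* + Δ n
    ≡⟨ cong₂ (λ x y → x ℤ.+ y ℤ.- + 2 ℤ.* + Δ n) (pair y₃) (pair y₄) ⟩
  Q-at n y₁ y₂ y₃ ℤ.+ Q-at n y₁ y₂ y₄ ℤ.- + 2 ℤ.* + Δ n ∎
  where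
  open ≡-Reasoning
  f₁₃ = f n y₁ y₃
  f₁₄ = f n y₁ y₄
  f₂₃ = f n y₂ y₃
  f₂₄ = f n y₂ y₄
  pos-+₄ : ∀ a b c e → + (a + b + c + e) ≡ + a ℤ.+ + b ℤ.+ + c ℤ.+ + e
  pos-+₄ a b c e = trans (ℤₚ.pos-+ (a + b + c) e)
    (cong (ℤ._+ + e) (trans (ℤₚ.pos-+ (a + b) c) (cong (ℤ._+ + c) (ℤₚ.pos-+ a b))))
  regroup : ∀ n Δ f₁₃ f₁₄ f₂₃ f₂₄ →
    + 2 ℤ.* (f₁₃ ℤ.+ f₁₄ ℤ.+ f₂₃ ℤ.+ f₂₄ ℤ.- (n ℤ.* n ℤ.+ Δ ℤ.- + 2 ℤ.* n)) ≡
    ((+ 2 ℤ.* f₁₃ ℤ.+ n) ℤ.+ (+ 2 ℤ.* f₂₃ ℤ.+ n) ℤ.- n ℤ.* n) ℤ.+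
    ((+ 2 ℤ.* f₁₄ ℤ.+ n) ℤ.+ (+ 2 ℤ.* f₂₄ ℤ.+ n) ℤ.- n ℤ.* n) ℤ.- + 2 ℤ.* Δ
  regroup = ℤ-solve-∀
  pair : ∀ w → (+ 2 ℤ.* + f n y₁ w ℤ.+ + n) ℤ.+ (+ 2 ℤ.* + f n y₂ w ℤ.+ + n) ℤ.- + n ℤ.* + n ≡ Q-at n y₁ y₂ w
  pair w = trans (cong₂ (λ x y → x ℤ.+ y ℤ.- + n ℤ.* + n) (2*f+n≡g n y₁ w) (2*f+n≡g n y₂ w))
                 (g+g-n²≡Q (+ n) (+ d n y₁ w) (+ d n y₂ w))

module _ {n : ℕ} where

  Q-flipˡ : (y w : Fin n) (β : ℤ) → Q (+ n) (+ d n y w) β ≡ Q (+ n) (+ d n w y) β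
  Q-flipˡ y w β with d-flip w y
  ... | inj₁ (wy≡0 , yw≡0) = cong (λ t → Q (+ n) (+ t) β) (trans yw≡0 (sym wy≡0))
  ... | inj₂ wy+yw≡n =
    trans (cong (λ t → Q (+ n) t β) (m+n≡o⇒+m≡+o-+n (trans (+-comm (d n y w) (d n w y)) wy+yw≡n)))
          (Q-reflectˡ (+ n) (+ d n w y) β)

  Q-at-flip : (y₁ y₂ w : Fin n) → Q-at n y₁ y₂ w ≡ Q (+ n) (+ d n w y₁) (+ d n w y₂)
  Q-at-flip y₁ y₂ w = begin
    Q (+ n) (+ d n y₁ w) (+ d n y₂ w) ≡⟨ Q-flipˡ y₁ w (+ d n y₂ w) ⟩
    Q (+ n) (+ d n w y₁) (+ d n y₂ w) ≡⟨ Q-comm (+ n) (+ d n w y₁) (+ d n y₂ w) ⟩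
    Q (+ n) (+ d n y₂ w) (+ d n w y₁) ≡⟨ Q-flipˡ y₂ w (+ d n w y₁) ⟩
    Q (+ n) (+ d n w y₂) (+ d n w y₁) ≡⟨ Q-comm (+ n) (+ d n w y₂) (+ d n w y₁) ⟩
    Q (+ n) (+ d n w y₁) (+ d n w y₂) ∎
    where open ≡-Reasoning

  sq+sq≡g-d : (k l : Fin n) → 0 < d n k l → sq (z n k l) ℤ.+ sq (n ∸ z n k l) ≡ g (+ n) (+ d n k l)
  sq+sq≡g-d k l 0<d = trans (sq+sq≡g (≤-trans (z≤d k l) (<⇒≤ (d<n k l)))) g-z≡g-d
    where
    g-z≡g-d : g (+ n) (+ z n k l) ≡ g (+ n) (+ d n k l)
    g-z≡g-d with z-sel k l
    ... | inj₁ z≡kl = cong (λ t → g (+ n) (+ t)) z≡kl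
    ... | inj₂ z≡lk = trans (cong (λ t → g (+ n) (+ t)) z≡lk)
      (trans (cong (g (+ n)) (m+n≡o⇒+m≡+o-+n {d n l k} {d n k l}
                               (trans (+-comm (d n l k) (d n k l)) (d+d≡n k l 0<d))))
             (g-reflect (+ n) (+ d n k l)))

  Q-at-bound : (y₁ y₂ w : Fin n) →
    sq (z n y₁ y₂) ℤ.- + (Δ n * Δ (z n y₁ y₂)) ℤ.≤ Q-at n y₁ y₂ w ℤ.- + Δ n
  Q-at-bound y₁ y₂ w = subst (λ t → sq z₁ ℤ.- + P ℤ.≤ t ℤ.- + Δ n) (sym Q-at≡u²+v²)
    (m+q≤o+n⇒+m-+n≤+o-+q {z₁ * z₁} {P} {u * u + v * v} {Δ n}
      (squares-parity-bound₂ (z≤∣d-d∣ y₁ y₂ w) (∣a-b∣+∣N-[a+b]∣≡N-mod2 n a b)))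
    where
    z₁ = z n y₁ y₂
    P = Δ n * Δ z₁
    a = d n w y₁
    b = d n w y₂
    u = ∣ a - b ∣
    v = ∣ n - (a + b) ∣
    Q-at≡u²+v² : Q-at n y₁ y₂ w ≡ + (u * u + v * v)
    Q-at≡u²+v² = trans (Q-at-flip y₁ y₂ w) (trans (Q≡sq+sq n a b) (sym (ℤₚ.pos-+ (u * u) (v * v))))

  nested-bound : ∀ {y₁ y₂ c e : Fin n} {s} →
    + 2 ℤ.* s ≡ Q-at n y₁ y₂ c ℤ.+ Q-at n y₁ y₂ e ℤ.- + 2 ℤ.* + Δ n →
    y₁ ∈[ c , e ] → y₂ ∈[ c , e ] →
    sq (z n y₁ y₂) ℤ.+ sq (z n c e) ℤ.- + (Δ n * Δ (z n y₁ y₂ + z n c e)) ℤ.≤ s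
  nested-bound {y₁} {y₂} {c} {e} {s} 2s≡ a≤L b≤L =
    subst₂ ℤ._≤_ (cong (ℤ._- + P) (ℤₚ.pos-+ (z₁ * z₁) (z₃ * z₃))) (sym s≡K-Δ)
      (m+q≤o+n⇒+m-+n≤+o-+q {z₁ * z₁ + z₃ * z₃} {P} {K} {Δ n}
        (squares-parity-bound (z≤∣d-d∣ y₁ y₂ c) (z≤n∸d c e) parity))
    where
    open ≡-Reasoning
    z₁ = z n y₁ y₂
    z₃ = z n c e
    P = Δ n * Δ (z₁ + z₃)
    a = d n c y₁
    b = d n c y₂
    L = d n c e
    L≤n : L ≤ n
    L≤n = <⇒≤ (d<n c e)
    u = ∣ a - b ∣
    v = ∣ L - (a + b) ∣
    m = n ∸ L
    K = u * u + v * v + m * m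
    rearrange : ∀ x L r → x + (L + x) + r ≡ (r + L) + x * 2
    rearrange = solve-∀
    parity : u + v + m ≡ n mod 2
    parity = mod-trans (mod-+ (mod-+ (∣m-n∣≡m+n-mod2 a b) (∣m-n∣≡m+n-mod2 L (a + b))) (≡⇒≡mod refl))
      (mod-trans (≡⇒≡mod (trans (rearrange (a + b) L m) (cong (_+ (a + b) * 2) (m∸n+n≡m L≤n))))
      (m+kn≡m-mod n (a + b)))
    +d≡+L-+d : ∀ {y} → d n c y ≤ L → + d n y e ≡ + L ℤ.- + d n c y
    +d≡+L-+d {y} cy≤L = trans (cong +_ (d-∸ c y e cy≤L)) (pos-∸ cy≤L)
    2K≡Q+Q : + 2 ℤ.* + K ≡ Q-at n y₁ y₂ c ℤ.+ Q-at n y₁ y₂ e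
    2K≡Q+Q = begin
      + 2 ℤ.* + K
        ≡⟨ cong (+ 2 ℤ.*_) (trans (ℤₚ.pos-+ (u * u + v * v) (m * m)) (cong (ℤ._+ sq m) (ℤₚ.pos-+ (u * u) (v * v)))) ⟩
      + 2 ℤ.* (sq u ℤ.+ sq v ℤ.+ sq m)
        ≡⟨ cong (+ 2 ℤ.*_) (cong₂ ℤ._+_ (cong₂ ℤ._+_ (sq-∣-∣ a b)
              (trans (sq-∣-∣ L (a + b)) (cong (λ t → (+ L ℤ.- t) ℤ.* (+ L ℤ.- t)) (ℤₚ.pos-+ a b))))
              (trans (ℤₚ.pos-* m m) (cong (λ t → t ℤ.* t) (pos-∸ L≤n)))) ⟩
      + 2 ℤ.* ((+ a ℤ.- + b) ℤ.* (+ a ℤ.- + b) ℤ.+ (+ L ℤ.- (+ a ℤ.+ + b)) ℤ.* (+ L ℤ.- (+ a ℤ.+ + b))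
               ℤ.+ (+ n ℤ.- + L) ℤ.* (+ n ℤ.- + L))
        ≡⟨ Q+Q-nested (+ n) (+ L) (+ a) (+ b) ⟨
      Q (+ n) (+ a) (+ b) ℤ.+ Q (+ n) (+ L ℤ.- + a) (+ L ℤ.- + b)
        ≡⟨ cong₂ ℤ._+_ (Q-at-flip y₁ y₂ c) (cong₂ (Q (+ n)) (+d≡+L-+d a≤L) (+d≡+L-+d b≤L)) ⟨
      Q-at n y₁ y₂ c ℤ.+ Q-at n y₁ y₂ e ∎
    factor : ∀ k δ → + 2 ℤ.* k ℤ.- + 2 ℤ.* δ ≡ + 2 ℤ.* (k ℤ.- δ)
    factor = ℤ-solve-∀
    s≡K-Δ : s ≡ + K ℤ.- + Δ n
    s≡K-Δ = ℤₚ.*-cancelˡ-≡ (+ 2) s (+ K ℤ.- + Δ n)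
      (trans 2s≡ (trans (cong (ℤ._- + 2 ℤ.* + Δ n) (sym 2K≡Q+Q)) (factor (+ K) (+ Δ n))))

  moreover-bound : ∀ {y₁ y₂ c e : Fin n} {s} →
    + 2 ℤ.* s ≡ Q-at n y₁ y₂ c ℤ.+ Q-at n y₁ y₂ e ℤ.- + 2 ℤ.* + Δ n →
    sq (z n y₁ y₂) ℤ.- + (Δ n * Δ (z n y₁ y₂)) ℤ.≤ s
  moreover-bound {y₁} {y₂} {c} {e} {s} 2s≡ = ℤₚ.*-cancelˡ-≤-pos X s (+ 2) (begin
    + 2 ℤ.* X                            ≡⟨ double X ⟩
    X ℤ.+ X                              ≤⟨ ℤₚ.+-mono-≤ (Q-at-bound y₁ y₂ c) (Q-at-bound y₁ y₂ e) ⟩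
    (Q-at n y₁ y₂ c ℤ.- + Δ n) ℤ.+ (Q-at n y₁ y₂ e ℤ.- + Δ n)
                                         ≡⟨ regroup (Q-at n y₁ y₂ c) (Q-at n y₁ y₂ e) (+ Δ n) ⟩
    Q-at n y₁ y₂ c ℤ.+ Q-at n y₁ y₂ e ℤ.- + 2 ℤ.* + Δ n ≡⟨ 2s≡ ⟨
    + 2 ℤ.* s                            ∎)
    where
    open ℤₚ.≤-Reasoning
    X = sq (z n y₁ y₂) ℤ.- + (Δ n * Δ (z n y₁ y₂))
    double : ∀ x → + 2 ℤ.* x ≡ x ℤ.+ x
    double = ℤ-solve-∀
    regroup : ∀ p q δ → (p ℤ.- δ) ℤ.+ (q ℤ.- δ) ≡ p ℤ.+ q ℤ.- + 2 ℤ.* δ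
    regroup = ℤ-solve-∀

  crossing-bound : ∀ {y₁ y₂ c e : Fin n} {s} →
    + 2 ℤ.* s ≡ Q-at n y₁ y₂ c ℤ.+ Q-at n y₁ y₂ e ℤ.- + 2 ℤ.* + Δ n →
    y₁ ∈⟨ c , e ⟩ → y₂ ∈⟨ e , c ⟩ →
    sq (z n y₁ y₂) ℤ.+ sq (n ∸ z n y₁ y₂) ℤ.+ sq (z n c e) ℤ.+ sq (n ∸ z n c e) ℤ.- + (2 * Δ n)
      ℤ.≤ + 4 ℤ.* s
  crossing-bound {y₁} {y₂} {c} {e} {s} 2s≡ (0<a , a<L) (0<B , B<M) =
    subst (ℤ._≤ + 4 ℤ.* s) (cong₂ ℤ._-_ (sym sq-sum≡G) (sym (ℤₚ.pos-* 2 (Δ n))))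
      (crossing-arithmetic {G} {+ Δ n} {Σ} {Q-at n y₁ y₂ c ℤ.+ Q-at n y₁ y₂ e} {s} 2s≡ 4Q≡2G+Σ 4Δ≤Σ)
    where
    open ≡-Reasoning
    a = d n c y₁
    L = d n c e
    B = d n e y₂
    M = d n e c
    δ = d n y₁ y₂
    a≤L : a ≤ L
    a≤L = <⇒≤ a<L
    L+M≡n : L + M ≡ n
    L+M≡n = d+d≡n c e (<-trans 0<a a<L)
    L+B<n : L + B < n
    L+B<n = subst (L + B <_) L+M≡n (+-monoʳ-< L B<M)
    δ≡L∸a+B : δ ≡ (L ∸ a) + B
    δ≡L∸a+B = trans (d-+ y₁ e y₂ y₁e+B<n) (cong (_+ B) y₁e≡L∸a)
      where
      y₁e≡L∸a : d n y₁ e ≡ L ∸ a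
      y₁e≡L∸a = d-∸ c y₁ e a≤L
      y₁e+B<n : d n y₁ e + B < n
      y₁e+B<n = subst (λ t → t + B < n) (sym y₁e≡L∸a) (≤-<-trans (+-monoˡ-≤ B (m∸n≤m L a)) L+B<n)
    Q-at-c : Q-at n y₁ y₂ c ≡ Q (+ n) (+ a) (+ L ℤ.+ + B)
    Q-at-c = trans (Q-at-flip y₁ y₂ c) (cong (Q (+ n) (+ a)) (trans (cong +_ (d-+ c e y₂ L+B<n)) (ℤₚ.pos-+ L B)))
    Q-at-e : Q-at n y₁ y₂ e ≡ Q (+ n) (+ n ℤ.- + L ℤ.+ + a) (+ B)
    Q-at-e = trans (Q-at-flip y₁ y₂ e) (cong (λ t → Q (+ n) t (+ B)) (begin
      + d n e y₁        ≡⟨ cong +_ (d-+ e c y₁ (subst (M + a <_) M+L≡n (+-monoʳ-< M a<L))) ⟩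
      + (M + a)         ≡⟨ ℤₚ.pos-+ M a ⟩
      + M ℤ.+ + a       ≡⟨ cong (ℤ._+ + a) (m+n≡o⇒+m≡+o-+n {M} {L} M+L≡n) ⟩
      + n ℤ.- + L ℤ.+ + a ∎))
      where
      M+L≡n : M + L ≡ n
      M+L≡n = trans (+-comm M L) L+M≡n
    G = g (+ n) (+ δ) ℤ.+ g (+ n) (+ L)
    Σ = [2k-n]² (+ n) (+ δ) ℤ.+ + 2 ℤ.* [2k-n]² (+ n) (+ (a + B)) ℤ.+ [2k-n]² (+ n) (+ L)
    4Q≡2G+Σ : + 4 ℤ.* (Q-at n y₁ y₂ c ℤ.+ Q-at n y₁ y₂ e) ≡ + 2 ℤ.* G ℤ.+ Σ
    4Q≡2G+Σ = begin
      + 4 ℤ.* (Q-at n y₁ y₂ c ℤ.+ Q-at n y₁ y₂ e)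
        ≡⟨ cong (+ 4 ℤ.*_) (cong₂ ℤ._+_ Q-at-c Q-at-e) ⟩
      + 4 ℤ.* (Q (+ n) (+ a) (+ L ℤ.+ + B) ℤ.+ Q (+ n) (+ n ℤ.- + L ℤ.+ + a) (+ B))
        ≡⟨ Q+Q-crossing (+ n) (+ L) (+ a) (+ B) ⟩
      + 2 ℤ.* (g (+ n) (+ L ℤ.- + a ℤ.+ + B) ℤ.+ g (+ n) (+ L)) ℤ.+
      ([2k-n]² (+ n) (+ L ℤ.- + a ℤ.+ + B) ℤ.+ + 2 ℤ.* [2k-n]² (+ n) (+ a ℤ.+ + B) ℤ.+ [2k-n]² (+ n) (+ L))
        ≡⟨ cong₂ (λ x y → + 2 ℤ.* (g (+ n) x ℤ.+ g (+ n) (+ L)) ℤ.+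
                          ([2k-n]² (+ n) x ℤ.+ + 2 ℤ.* [2k-n]² (+ n) y ℤ.+ [2k-n]² (+ n) (+ L)))
                 (sym +δ) (sym (ℤₚ.pos-+ a B)) ⟩
      + 2 ℤ.* G ℤ.+ Σ ∎
      where
      +δ : + δ ≡ + L ℤ.- + a ℤ.+ + B
      +δ = trans (cong +_ δ≡L∸a+B) (trans (ℤₚ.pos-+ (L ∸ a) B) (cong (ℤ._+ + B) (pos-∸ a≤L)))
    4Δ≤Σ : + 4 ℤ.* + Δ n ℤ.≤ Σ
    4Δ≤Σ = subst (ℤ._≤ Σ) (regroup (+ Δ n))
      (ℤₚ.+-mono-≤ (ℤₚ.+-mono-≤ (Δ≤[2k-n]² n δ) (ℤₚ.*-monoˡ-≤-nonNeg (+ 2) (Δ≤[2k-n]² n (a + B))))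
                   (Δ≤[2k-n]² n L))
      where
      regroup : ∀ x → x ℤ.+ + 2 ℤ.* x ℤ.+ x ≡ + 4 ℤ.* x
      regroup = ℤ-solve-∀
    sq-sum≡G : sq (z n y₁ y₂) ℤ.+ sq (n ∸ z n y₁ y₂) ℤ.+ sq (z n c e) ℤ.+ sq (n ∸ z n c e) ≡ G
    sq-sum≡G = trans (ℤₚ.+-assoc (sq (z n y₁ y₂) ℤ.+ sq (n ∸ z n y₁ y₂)) (sq (z n c e)) (sq (n ∸ z n c e)))
      (cong₂ ℤ._+_ (sq+sq≡g-d y₁ y₂ (subst (0 <_) (sym δ≡L∸a+B) (<-≤-trans 0<B (m≤n+m B (L ∸ a)))))
                   (sq+sq≡g-d c e (<-trans 0<a a<L)))

lemma7 : (n : ℕ) → 3 ≤ n → (y₁ y₂ y₃ y₄ : Fin n) →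
    ((y₁ ∈[ y₃ , y₄ ] × y₂ ∈[ y₃ , y₄ ]) ⊎ (y₁ ∈[ y₄ , y₃ ] × y₂ ∈[ y₄ , y₃ ]) →
      (sq (z n y₁ y₂) ℤ.+ sq (z n y₃ y₄))
        ℤ.- (+ (Δ n ℕ.* Δ (z n y₁ y₂ ℕ.+ z n y₃ y₄)))
        ℤ.≤ S n y₁ y₂ y₃ y₄)
  ×
    ((y₁ ∈⟨ y₃ , y₄ ⟩ × y₂ ∈⟨ y₄ , y₃ ⟩) ⊎ (y₂ ∈⟨ y₃ , y₄ ⟩ × y₁ ∈⟨ y₄ , y₃ ⟩) →
      (sq (z n y₁ y₂) ℤ.+ sq (n ∸ z n y₁ y₂) ℤ.+ sq (z n y₃ y₄) ℤ.+ sq (n ∸ z n y₃ y₄))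
        ℤ.- (+ (2 ℕ.* Δ n))
        ℤ.≤ (+ 4) ℤ.* S n y₁ y₂ y₃ y₄)
  ×
    (sq (z n y₁ y₂) ℤ.- (+ (Δ n ℕ.* Δ (z n y₁ y₂))) ℤ.≤ S n y₁ y₂ y₃ y₄)
lemma7 n _ y₁ y₂ y₃ y₄ =
    (λ { (inj₁ (y₁∈ , y₂∈)) → nested-bound {n} {y₁} {y₂} {y₃} {y₄} 2S y₁∈ y₂∈
       ; (inj₂ (y₁∈ , y₂∈)) →
           subst (λ t → sq (z n y₁ y₂) ℤ.+ sq t ℤ.- + (Δ n * Δ (z n y₁ y₂ + t)) ℤ.≤ s) (z-comm y₄ y₃)
             (nested-bound {n} {y₁} {y₂} {y₄} {y₃} 2S-swap₃₄ y₁∈ y₂∈) })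
  , (λ { (inj₁ (y₁∈ , y₂∈)) → crossing-bound {n} {y₁} {y₂} {y₃} {y₄} 2S y₁∈ y₂∈
       ; (inj₂ (y₂∈ , y₁∈)) →
           subst (λ t → sq t ℤ.+ sq (n ∸ t) ℤ.+ sq (z n y₃ y₄) ℤ.+ sq (n ∸ z n y₃ y₄) ℤ.- + (2 * Δ n) ℤ.≤ + 4 ℤ.* s)
             (z-comm y₂ y₁) (crossing-bound {n} {y₂} {y₁} {y₃} {y₄} 2S-swap₁₂ y₂∈ y₁∈) })
  , moreover-bound {n} {y₁} {y₂} {y₃} {y₄} 2S
  where
  s = S n y₁ y₂ y₃ y₄
  2Δ = + 2 ℤ.* + Δ n
  2S : + 2 ℤ.* s ≡ Q-at n y₁ y₂ y₃ ℤ.+ Q-at n y₁ y₂ y₄ ℤ.- 2Δ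
  2S = 2*S≡Q-at+Q-at-2Δ n y₁ y₂ y₃ y₄
  2S-swap₃₄ : + 2 ℤ.* s ≡ Q-at n y₁ y₂ y₄ ℤ.+ Q-at n y₁ y₂ y₃ ℤ.- 2Δ
  2S-swap₃₄ = trans 2S (cong (ℤ._- 2Δ) (ℤₚ.+-comm (Q-at n y₁ y₂ y₃) (Q-at n y₁ y₂ y₄)))
  2S-swap₁₂ : + 2 ℤ.* s ≡ Q-at n y₂ y₁ y₃ ℤ.+ Q-at n y₂ y₁ y₄ ℤ.- 2Δ
  2S-swap₁₂ = trans 2S (cong₂ (λ p q → p ℤ.+ q ℤ.- 2Δ)
    (Q-comm (+ n) (+ d n y₁ y₃) (+ d n y₂ y₃)) (Q-comm (+ n) (+ d n y₁ y₄) (+ d n y₂ y₄)))
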